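{- Let $X$ be a nonempty set and let $f,g:(Y,R)\to (Z,\tilde R)$ be morphisms of relations on $X$. Then the induced simplicial maps $L_f,L_g:L_Y\to L_Z$ are contiguous. In particular, $|L_f|$ and $|L_g|$ are homotopic continuous maps.
   Context: A relation on $X$ is a pair $(Y,R)$ with $Y$ a nonempty set and $R\subseteq X\times Y$. A morphism $f:(Y,R)\to(Z,\tilde R)$ is a map $f:Y\to Z$ such that $xRy$ implies $x\tilde R f(y)$. $L_Y$ is the simplicial complex whose simplices are the nonempty finite subsets of $Y$ all of whose elements are related (via $R$) to a common element of $X$. A morphism $f$ induces the simplicial map $L_f:L_Y\to L_Z$ given on vertices by $f$. Here $|\cdot|$ denotes geometric realization. -}

module Defs where

open import Level using (Level; _⊔_; suc)
open import Data.Product using (Σ; ∃; ∃-syntax; _×_)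
open import Data.List.NonEmpty using (List⁺; toList; _⁺++⁺_)
open import Data.List.NonEmpty as List⁺ using ()
open import Data.List.Relation.Unary.All using (All)

-- A relation on X: a nonempty set Y (witness `point`) and R ⊆ X × Y.
record RelationOn {ℓ : Level} (X : Set ℓ) : Set (suc ℓ) where
  field
    Carrier : Set ℓ
    point   : Carrier
    Rel     : X → Carrier → Set ℓ

open RelationOn public

IsMorphism : {ℓ : Level} {X : Set ℓ} (A B : RelationOn X) →
             (Carrier A → Carrier B) → Set ℓ
IsMorphism {X = X} A B f = ∀ (x : X) (y : Carrier A) → Rel A x y → Rel B x (f y)

-- A simplicial complex on a vertex set V is represented by its predicate of
-- simplices on nonempty finite lists of vertices (a list represents the finite
-- nonempty set of its entries).
IsSimplexL : {ℓ : Level} {X : Set ℓ} (A : RelationOn X) → List⁺ (Carrier A) → Set ℓ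
IsSimplexL {X = X} A σ = ∃[ x ] All (Rel A x) (toList σ)

IsSimplicialMap : {ℓ : Level} {V W : Set ℓ} →
                  (List⁺ V → Set ℓ) → (List⁺ W → Set ℓ) → (V → W) → Set ℓ
IsSimplicialMap SV SW f = ∀ σ → SV σ → SW (List⁺.map f σ)

Contiguous : {ℓ : Level} {V W : Set ℓ} →
             (List⁺ V → Set ℓ) → (List⁺ W → Set ℓ) → (V → W) → (V → W) → Set ℓ
Contiguous SV SW f g =
  IsSimplicialMap SV SW f × IsSimplicialMap SV SW g ×
  (∀ σ → SV σ → SW (List⁺.map f σ ⁺++⁺ List⁺.map g σ))

{-# OPTIONS --safe #-}
module Submission where

-- A simplex of L_Y is a finite subset of the star {y | x R y} of some x ∈ X, and every
-- morphism maps the star of x in Y into the star of x in Z.  Hence f(σ) ∪ g(σ) lies in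
-- a single star of Z, which is the contiguity condition.

open import Defs
open import Level using (Level)
open import Data.Product using (_,_)
open import Data.List as List using (List)
open import Data.List.NonEmpty as List⁺ using (_∷_; _⁺++⁺_)
open import Data.List.Relation.Unary.All as All using (All)
open import Data.List.Relation.Unary.All.Properties using (map⁺; ++⁺)

module _ {ℓ : Level} {X : Set ℓ} (A B : RelationOn X) where

  morphism-map-All : ∀ {f} → IsMorphism A B f →
                     ∀ {x ys} → All (Rel A x) ys → All (Rel B x) (List.map f ys)
  morphism-map-All f-mor {x} xRys = map⁺ (All.map (λ {y} → f-mor x y) xRys)

  morphism⇒simplicial : ∀ f → IsMorphism A B f →
                        IsSimplicialMap (IsSimplexL A) (IsSimplexL B) f
  morphism⇒simplicial f f-mor (_ ∷ _) (x , xRσ) = x , morphism-map-All f-mor xRσ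

  morphisms⇒image-union-simplex : ∀ f g → IsMorphism A B f → IsMorphism A B g →
                                  ∀ σ → IsSimplexL A σ →
                                  IsSimplexL B (List⁺.map f σ ⁺++⁺ List⁺.map g σ)
  morphisms⇒image-union-simplex f g f-mor g-mor (_ ∷ _) (x , xRσ) =
    x , ++⁺ (morphism-map-All f-mor xRσ) (morphism-map-All g-mor xRσ)

  morphisms⇒contiguous : ∀ f g → IsMorphism A B f → IsMorphism A B g →
                         Contiguous (IsSimplexL A) (IsSimplexL B) f g
  morphisms⇒contiguous f g f-mor g-mor =
    morphism⇒simplicial f f-mor ,
    morphism⇒simplicial g g-mor ,
    morphisms⇒image-union-simplex f g f-mor g-mor

mainTheorem3 : {ℓ : Level} (X : Set ℓ) → X → (A B : RelationOn X)
               (f g : Carrier A → Carrier B) →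
               IsMorphism A B f → IsMorphism A B g →
               Contiguous (IsSimplexL A) (IsSimplexL B) f g
mainTheorem3 X _ = morphisms⇒contiguous
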